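{- Let $K=(S,L,\to)$ be a Kripke structure and $\mathcal C$ a colouring of $S$ such that any two states with the same colour satisfy the same atomic propositions and have the same $\mathcal C$-coloured traces of length two. Then $\mathcal C$ is consistent.
   Context: Fix a set $AP$ of atomic propositions. Kripke structure: $(S,L,\to)$, $L:S\to2^{AP}$, $\to\subseteq S\times S$. A path from $s$ is a finite or infinite sequence $s_0,s_1,\dots$ with $s_0=s$, $s_k\to s_{k+1}$. A colouring is a function $\mathcal C:S\to\mathbf C$; for a path $\pi$, $\mathcal C(\pi)$ is the sequence $\mathcal C(s_0),\mathcal C(s_1),\dots$ with every finite or infinite maximal block of equal consecutive colours contracted to one occurrence; it is a $\mathcal C$-coloured trace of $s_0$ (of length two if it consists of exactly two colours). $\mathcal C$ is consistent if any two states of the same colour satisfy the same atomic propositions and have the same $\mathcal C$-coloured traces. -}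

module Defs where

open import Data.Nat using (ℕ; zero; suc; _≤_)
open import Data.Bool using (Bool)
open import Data.Unit using (⊤)
open import Data.Product using (Σ; _×_; _,_; ∃; proj₁; proj₂)
open import Data.Sum using (_⊎_)
open import Relation.Binary.PropositionalEquality using (_≡_; _≢_)

-- Kripke structure over a set AP of atomic propositions.
-- L s p ≡ true means "state s satisfies atomic proposition p" (L : S → 2^AP).
record Kripke (AP : Set) : Set₁ where
  field
    S   : Set
    L   : S → AP → Bool
    _⟶_ : S → S → Set

-- Lengths of non-empty finite or infinite sequences:
-- fin n = n+1 elements (indices 0..n), inf = infinitely many (indices ℕ).
data Len : Set where
  fin : ℕ → Len
  inf : Len

InRange : Len → ℕ → Set
InRange (fin n) i = i ≤ n
InRange inf     i = ⊤

-- A non-empty finite or infinite sequence: a length and the entries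
-- (only entries at in-range indices are meaningful).
Seq : Set → Set
Seq A = Len × (ℕ → A)

module _ {AP : Set} (K : Kripke AP) where
  open Kripke K

  IsPath : S → Seq S → Set
  IsPath s (l , f) = (f 0 ≡ s) × (∀ i → InRange l (suc i) → f i ⟶ f (suc i))

  module _ {Col : Set} (𝒞 : S → Col) where

    -- Contracts π τ : τ is 𝒞(π), i.e. the colour sequence of π with every
    -- maximal block of equal consecutive colours contracted to one entry.
    -- h i is the index (in τ) of the block containing position i of π.
    Contracts : Seq S → Seq Col → Set
    Contracts (l , f) (l' , g) =
      Σ (ℕ → ℕ) λ h →
        (h 0 ≡ 0)
        × (∀ i → InRange l (suc i) →
             ((h (suc i) ≡ h i) × (𝒞 (f i) ≡ 𝒞 (f (suc i))))
             ⊎ ((h (suc i) ≡ suc (h i)) × (𝒞 (f i) ≢ 𝒞 (f (suc i)))))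
        × (∀ i → InRange l i → InRange l' (h i) × (g (h i) ≡ 𝒞 (f i)))
        × (∀ j → InRange l' j → Σ ℕ λ i → InRange l i × (h i ≡ j))

    ColTrace : S → Seq Col → Set
    ColTrace s τ = Σ (Seq S) λ π → IsPath s π × Contracts π τ

    -- coloured trace of length two: exactly two colours
    LengthTwo : Seq Col → Set
    LengthTwo τ = proj₁ τ ≡ fin 1

    SameProps : S → S → Set
    SameProps s s' = ∀ p → L s p ≡ L s' p

    SameTraces : S → S → Set
    SameTraces s s' = ∀ τ → (ColTrace s τ → ColTrace s' τ) × (ColTrace s' τ → ColTrace s τ)

    SameTraces₂ : S → S → Set
    SameTraces₂ s s' = ∀ τ → LengthTwo τ →
      (ColTrace s τ → ColTrace s' τ) × (ColTrace s' τ → ColTrace s τ)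

    Consistent : Set
    Consistent = ∀ s s' → 𝒞 s ≡ 𝒞 s' → SameProps s s' × SameTraces s s'

-- A coloured trace of s is a chain of colour changes g 0 → g 1 → ⋯, and each change
-- g j → g (j+1) is witnessed on some path of s by an edge between blocks, i.e. by a
-- coloured trace of length two. Two-step traces are shared by equally coloured states,
-- so starting from s' one can follow, for every j, a walk that stays in colour g j and
-- then enters colour g (j+1); concatenating these walks gives a path of s' whose
-- contraction is the same coloured trace.
module Submission where

open import Defs
open import Data.Product using (_×_)
open import Relation.Binary.PropositionalEquality using (_≡_)

open import Data.Nat
open import Data.Nat.Properties
open import Data.Product using (Σ; _,_; proj₁; proj₂)
open import Data.Sum using (_⊎_; inj₁; inj₂)
open import Data.Unit using (tt)
open import Relation.Nullary using (Dec; yes; no; contradiction)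
open import Relation.Binary.PropositionalEquality
  using (_≢_; refl; sym; trans; cong; cong₂; subst; module ≡-Reasoning)

InRange-≤ : ∀ l {i j} → j ≤ i → InRange l i → InRange l j
InRange-≤ (fin n) j≤i i≤n = ≤-trans j≤i i≤n
InRange-≤ inf     _   _   = tt

InRange-0 : ∀ l → InRange l 0
InRange-0 (fin n) = z≤n
InRange-0 inf     = tt

InRange? : ∀ l i → Dec (InRange l i)
InRange? (fin n) i = i ≤? n
InRange? inf     i = yes tt

pairSeq : {A : Set} → A → A → Seq A
pairSeq x y = fin 1 , λ { zero → x ; (suc _) → y }

-- ℕ cut into consecutive blocks, block j having suc (len j) positions.
module Blocks (len : ℕ → ℕ) where

  start : ℕ → ℕ
  start zero    = 0
  start (suc j) = suc (len j + start j)

  next : ℕ × ℕ → ℕ × ℕ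
  next (j , k) with k <? len j
  ... | yes _ = j , suc k
  ... | no  _ = suc j , 0

  position : ℕ → ℕ × ℕ
  position zero    = 0 , 0
  position (suc i) = next (position i)

  blockOf offset : ℕ → ℕ
  blockOf i = proj₁ (position i)
  offset  i = proj₂ (position i)

  Decomposes : ℕ → ℕ × ℕ → Set
  Decomposes i (j , k) = k ≤ len j × i ≡ k + start j

  next-cases : ∀ j k → k ≤ len j →
    (next (j , k) ≡ (j , suc k) × k < len j) ⊎ (next (j , k) ≡ (suc j , 0) × k ≡ len j)
  next-cases j k k≤ with k <? len j
  ... | yes k< = inj₁ (refl , k<)
  ... | no  k≮ = inj₂ (refl , ≤-antisym k≤ (≮⇒≥ k≮))

  next-inner : ∀ {j k} → k < len j → next (j , k) ≡ (j , suc k)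
  next-inner {j} {k} k< with k <? len j
  ... | yes _  = refl
  ... | no  k≮ = contradiction k< k≮

  next-last : ∀ j → next (j , len j) ≡ (suc j , 0)
  next-last j with len j <? len j
  ... | yes j< = contradiction j< (<-irrefl refl)
  ... | no  _  = refl

  position-decomposes : ∀ i → Decomposes i (position i)
  position-suc : ∀ i →
    (position (suc i) ≡ (blockOf i , suc (offset i)) × offset i < len (blockOf i))
    ⊎ (position (suc i) ≡ (suc (blockOf i) , 0) × offset i ≡ len (blockOf i))

  position-suc i = next-cases (blockOf i) (offset i) (proj₁ (position-decomposes i))

  position-decomposes zero = z≤n , refl
  position-decomposes (suc i) with position-suc i
  ... | inj₁ (e , k<) = subst (Decomposes (suc i)) (sym e) (k< , cong suc i≡)
    where i≡ = proj₂ (position-decomposes i)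
  ... | inj₂ (e , k≡) = subst (Decomposes (suc i)) (sym e)
                          (z≤n , cong suc (trans i≡ (cong (_+ start (blockOf i)) k≡)))
    where i≡ = proj₂ (position-decomposes i)

  position-start : ∀ j → position (start j) ≡ (j , 0)
  position-start+ : ∀ j k → k ≤ len j → position (k + start j) ≡ (j , k)

  position-start zero    = refl
  position-start (suc j) = trans (cong next (position-start+ j (len j) ≤-refl)) (next-last j)

  position-start+ j zero    _  = position-start j
  position-start+ j (suc k) k< = trans (cong next (position-start+ j k (<⇒≤ k<))) (next-inner k<)

  start-blockOf≤ : ∀ i → start (blockOf i) ≤ i
  start-blockOf≤ i = subst (start (blockOf i) ≤_) (sym (proj₂ (position-decomposes i)))
                       (m≤n+m _ (offset i))

  start-suc : ∀ j → start j < start (suc j)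
  start-suc j = s≤s (m≤n+m (start j) (len j))

  start-mono-≤′ : ∀ {a b} → a ≤′ b → start a ≤ start b
  start-mono-≤′ ≤′-refl      = ≤-refl
  start-mono-≤′ (≤′-step a≤b) = ≤-trans (start-mono-≤′ a≤b) (<⇒≤ (start-suc _))

  start-mono-≤ : ∀ {a b} → a ≤ b → start a ≤ start b
  start-mono-≤ a≤b = start-mono-≤′ (≤⇒≤′ a≤b)

  start-cancel-≤ : ∀ {a b} → start a ≤ start b → a ≤ b
  start-cancel-≤ {a} {b} sa≤sb with a ≤? b
  ... | yes a≤b = a≤b
  ... | no  a≰b = contradiction sa≤sb (<⇒≱ (<-≤-trans (start-suc b) (start-mono-≤ (≰⇒> a≰b))))

  start-cancel-< : ∀ {a b} → start a < start b → a < b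
  start-cancel-< {a} {b} sa<sb with a <? b
  ... | yes a<b = a<b
  ... | no  a≮b = contradiction (start-mono-≤ (≮⇒≥ a≮b)) (<⇒≱ sa<sb)

  -- A path of length startLen (fin n) ends at the first position of block n.
  startLen : Len → Len
  startLen (fin n) = fin (start n)
  startLen inf     = inf

  InRange-start : ∀ l {j} → InRange l j → InRange (startLen l) (start j)
  InRange-start (fin n) j≤n = start-mono-≤ j≤n
  InRange-start inf     _   = tt

  InRange-start⁻¹ : ∀ l {j i} → start j ≤ i → InRange (startLen l) i → InRange l j
  InRange-start⁻¹ (fin n) sj≤i i≤ = start-cancel-≤ (≤-trans sj≤i i≤)
  InRange-start⁻¹ inf     _    _  = tt

  InRange-suc-start⁻¹ : ∀ l {j i} → start j < i → InRange (startLen l) i → InRange l (suc j)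
  InRange-suc-start⁻¹ (fin n) sj<i i≤ = start-cancel-< (<-≤-trans sj<i i≤)
  InRange-suc-start⁻¹ inf     _    _  = tt

module _ {AP : Set} (K : Kripke AP) {Col : Set} (𝒞 : Kripke.S K → Col) where
  open Kripke K

  edge-trace : ∀ {x y} → x ⟶ y → 𝒞 x ≢ 𝒞 y → ColTrace K 𝒞 x (pairSeq (𝒞 x) (𝒞 y))
  edge-trace {x} {y} x⟶y x≁y =
    pairSeq x y ,
    (refl , λ { zero _ → x⟶y ; (suc _) (s≤s ()) }) ,
    (λ i → i) , refl ,
    (λ { zero _ → inj₂ (refl , x≁y) ; (suc _) (s≤s ()) }) ,
    (λ { zero r → r , refl ; (suc _) r → r , refl }) ,
    (λ j r → j , r , refl)

  module Contraction {l : Len} {f : ℕ → S} {l' : Len} {g : ℕ → Col}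
                     (c : Contracts K 𝒞 (l , f) (l' , g)) where

    h : ℕ → ℕ
    h = proj₁ c

    h-0 : h 0 ≡ 0
    h-0 = proj₁ (proj₂ c)

    h-step : ∀ i → InRange l (suc i) →
      ((h (suc i) ≡ h i) × (𝒞 (f i) ≡ 𝒞 (f (suc i))))
      ⊎ ((h (suc i) ≡ suc (h i)) × (𝒞 (f i) ≢ 𝒞 (f (suc i))))
    h-step = proj₁ (proj₂ (proj₂ c))

    colour : ∀ {i} → InRange l i → 𝒞 (f i) ≡ g (h i)
    colour {i} r = sym (proj₂ (proj₁ (proj₂ (proj₂ (proj₂ c))) i r))

    h-onto : ∀ j → InRange l' j → Σ ℕ λ i → InRange l i × (h i ≡ j)
    h-onto = proj₂ (proj₂ (proj₂ (proj₂ c)))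

    h-mono-step : ∀ i → InRange l (suc i) → h i ≤ h (suc i)
    h-mono-step i r with h-step i r
    ... | inj₁ (e , _) = ≤-reflexive (sym e)
    ... | inj₂ (e , _) = ≤-trans (n≤1+n (h i)) (≤-reflexive (sym e))

    h-mono : ∀ {k i} → k ≤′ i → InRange l i → h k ≤ h i
    h-mono ≤′-refl           _ = ≤-refl
    h-mono (≤′-step {i} k≤i) r =
      ≤-trans (h-mono k≤i (InRange-≤ l (n≤1+n i) r)) (h-mono-step i r)

    -- Walking back from a position of block suc j, the first change of h is the
    -- edge where block j ends.
    crossing : ∀ {i j} → InRange l i → h i ≡ suc j →
      Σ ℕ λ c → InRange l (suc c) × h c ≡ j × h (suc c) ≡ suc j × 𝒞 (f c) ≢ 𝒞 (f (suc c))
    crossing {zero}  _ e = contradiction (trans (sym h-0) e) (λ ())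
    crossing {suc i} r e with h-step i r
    ... | inj₁ (same , _)   = crossing (InRange-≤ l (n≤1+n i) r) (trans (sym same) e)
    ... | inj₂ (stepped , ≁) = i , r , suc-injective (trans (sym stepped) e) , e , ≁

    crossing-at : ∀ {j} → InRange l' (suc j) →
      Σ ℕ λ c → InRange l (suc c) × h c ≡ j × h (suc c) ≡ suc j × 𝒞 (f c) ≢ 𝒞 (f (suc c))
    crossing-at {j} r = crossing (proj₁ (proj₂ onto)) (proj₂ (proj₂ onto))
      where onto = h-onto (suc j) r

  trace-head : ∀ {s l' g} → ColTrace K 𝒞 s (l' , g) → 𝒞 s ≡ g 0
  trace-head {s} {l'} {g} ((l , f) , (f0 , _) , c) = begin
    𝒞 s          ≡⟨ cong 𝒞 (sym f0) ⟩
    𝒞 (f 0)      ≡⟨ colour (InRange-0 l) ⟩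
    g (h 0)      ≡⟨ cong g h-0 ⟩
    g 0          ∎
    where open Contraction {l} {f} {l'} {g} c
          open ≡-Reasoning

  adjacent-pair : ∀ {s l' g j} → ColTrace K 𝒞 s (l' , g) → InRange l' (suc j) →
    Σ S λ x → 𝒞 x ≡ g j × ColTrace K 𝒞 x (pairSeq (g j) (g (suc j)))
  adjacent-pair {l' = l'} {g} ((l , f) , (_ , f⟶) , c) r
    with Contraction.crossing-at {l} {f} {l'} {g} c r
  ... | i , ri , hi , hsi , ≁ =
    f i , colour-i ,
    subst (ColTrace K 𝒞 (f i)) (cong₂ pairSeq colour-i colour-si) (edge-trace (f⟶ i ri) ≁)
    where
      open Contraction {l} {f} {l'} {g} c
      colour-i : 𝒞 (f i) ≡ g _
      colour-i = trans (colour (InRange-≤ l (n≤1+n i) ri)) (cong g hi)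
      colour-si : 𝒞 (f (suc i)) ≡ g _
      colour-si = trans (colour ri) (cong g hsi)

  record Walk : Set where
    field
      steps : ℕ
      state : ℕ → S

    end : S
    end = state (suc steps)

  open Walk

  stay : S → Walk
  stay t = record { steps = 0 ; state = λ _ → t }

  record IsCrossing (w : Walk) (a b : Col) : Set where
    field
      walk-⟶      : ∀ k → k ≤ steps w → state w k ⟶ state w (suc k)
      colour-walk : ∀ k → k ≤ steps w → 𝒞 (state w k) ≡ a
      colour-end  : 𝒞 (end w) ≡ b
      distinct    : a ≢ b

  open IsCrossing

  Crossing : S → Col → Col → Set
  Crossing t a b = Σ Walk λ w → state w 0 ≡ t × IsCrossing w a b

  -- Cut the path at its first change of colour.
  toCrossing : ∀ {t a b} → ColTrace K 𝒞 t (pairSeq a b) → Crossing t a b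
  toCrossing {a = a} {b} ((l , f) , (f0 , f⟶) , c)
    with Contraction.crossing-at {l} {f} {fin 1} {proj₂ (pairSeq a b)} c {0} (s≤s z≤n)
  ... | m , rm , hm , hsm , ≁ =
    record { steps = m ; state = f } , f0 ,
    record { walk-⟶      = λ k k≤m → f⟶ k (InRange-≤ l (s≤s k≤m) rm)
           ; colour-walk = colour-walk′
           ; colour-end  = colour-end′
           ; distinct    = λ a≡b → ≁ (trans (colour-walk′ m ≤-refl) (trans a≡b (sym colour-end′))) }
    where
      open Contraction {l} {f} {fin 1} {proj₂ (pairSeq a b)} c
      rm′ : InRange l m
      rm′ = InRange-≤ l (n≤1+n m) rm
      colour-walk′ : ∀ k → k ≤ m → 𝒞 (f k) ≡ a
      colour-walk′ k k≤m = trans (colour (InRange-≤ l k≤m rm′))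
        (cong (proj₂ (pairSeq a b)) (n≤0⇒n≡0 (subst (h k ≤_) hm (h-mono (≤⇒≤′ k≤m) rm′))))
      colour-end′ : 𝒞 (f (suc m)) ≡ b
      colour-end′ = trans (colour rm) (cong (proj₂ (pairSeq a b)) hsm)

  module Concat (l' : Len) (g : ℕ → Col) (w : ℕ → Walk)
                (linked : ∀ j → state (w (suc j)) 0 ≡ end (w j))
                (colour-0 : 𝒞 (state (w 0) 0) ≡ g 0)
                (crosses : ∀ j → InRange l' (suc j) → IsCrossing (w j) (g j) (g (suc j))) where
    open Blocks (λ j → steps (w j))

    at : ℕ × ℕ → S
    at (j , k) = state (w j) k

    concat : ℕ → S
    concat i = at (position i)

    concat-suc : ∀ i → concat (suc i) ≡ state (w (blockOf i)) (suc (offset i))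
    concat-suc i with position-suc i
    ... | inj₁ (e , _)  = cong at e
    ... | inj₂ (e , k≡) = trans (cong at e)
                            (trans (linked _) (cong (λ k → state (w (blockOf i)) (suc k)) (sym k≡)))

    colour-start : ∀ j → InRange l' j → 𝒞 (state (w j) 0) ≡ g j
    colour-start zero    _ = colour-0
    colour-start (suc j) r = trans (cong 𝒞 (linked j)) (colour-end (crosses j r))

    colour-at : ∀ {i} j k → k ≤ steps (w j) → i ≡ k + start j → InRange (startLen l') i →
      𝒞 (state (w j) k) ≡ g j
    colour-at j zero    _  i≡ r = colour-start j (InRange-start⁻¹ l' (≤-reflexive (sym i≡)) r)
    colour-at j (suc k) k≤ i≡ r = colour-walk (crosses j (InRange-suc-start⁻¹ l' sj<i r)) (suc k) k≤
      where sj<i = subst (start j <_) (sym i≡) (s≤s (m≤n+m (start j) k))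

    colour-concat : ∀ {i} → InRange (startLen l') i → 𝒞 (concat i) ≡ g (blockOf i)
    colour-concat {i} = colour-at (blockOf i) (offset i)
                          (proj₁ (position-decomposes i)) (proj₂ (position-decomposes i))

    next-block-in-range : ∀ {i} → InRange (startLen l') (suc i) → InRange l' (suc (blockOf i))
    next-block-in-range {i} = InRange-suc-start⁻¹ l' (s≤s (start-blockOf≤ i))

    concat-⟶ : ∀ i → InRange (startLen l') (suc i) → concat i ⟶ concat (suc i)
    concat-⟶ i r = subst (concat i ⟶_) (sym (concat-suc i))
      (walk-⟶ (crosses _ (next-block-in-range r)) (offset i) (proj₁ (position-decomposes i)))

    concat-contracts : Contracts K 𝒞 (startLen l' , concat) (l' , g)
    concat-contracts =
      blockOf , refl , step ,
      (λ i r → InRange-start⁻¹ l' (start-blockOf≤ i) r , sym (colour-concat r)) ,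
      (λ j r → start j , InRange-start l' r , cong proj₁ (position-start j))
      where
        step : ∀ i → InRange (startLen l') (suc i) →
          ((blockOf (suc i) ≡ blockOf i) × (𝒞 (concat i) ≡ 𝒞 (concat (suc i))))
          ⊎ ((blockOf (suc i) ≡ suc (blockOf i)) × (𝒞 (concat i) ≢ 𝒞 (concat (suc i))))
        step i r with position-suc i
        ... | inj₁ (e , _) = inj₁ (cong proj₁ e ,
                trans (colour-concat r′) (sym (trans (colour-concat r) (cong g (cong proj₁ e)))))
          where r′ = InRange-≤ (startLen l') (n≤1+n i) r
        ... | inj₂ (e , _) = inj₂ (cong proj₁ e , λ same →
                distinct (crosses _ (next-block-in-range r))
                  (trans (sym (colour-concat r′))
                    (trans same (trans (colour-concat r) (cong g (cong proj₁ e))))))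
          where r′ = InRange-≤ (startLen l') (n≤1+n i) r

  module Transfer (hyp : ∀ s s' → 𝒞 s ≡ 𝒞 s' → SameProps K 𝒞 s s' × SameTraces₂ K 𝒞 s s')
                  {s s' : S} (s~s' : 𝒞 s ≡ 𝒞 s') {l' : Len} {g : ℕ → Col}
                  (trace : ColTrace K 𝒞 s (l' , g)) where

    crossing-from : ∀ {j t} → 𝒞 t ≡ g j → InRange l' (suc j) → Crossing t (g j) (g (suc j))
    crossing-from {j} {t} t~j r with adjacent-pair {l' = l'} {g} trace r
    ... | x , x~j , x-trace =
      toCrossing (proj₁ (proj₂ (hyp x t (trans x~j (sym t~j))) (pairSeq (g j) (g (suc j))) refl) x-trace)

    Segment : ℕ → S → Set
    Segment j t = Σ Walk λ w → state w 0 ≡ t × (InRange l' (suc j) → IsCrossing w (g j) (g (suc j)))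

    -- Beyond the end of a finite trace any walk from t will do.
    segment : ∀ j t → (InRange l' j → 𝒞 t ≡ g j) → Segment j t
    segment j t t~j with InRange? l' (suc j)
    ... | yes r  = let w , w0 , ok = crossing-from (t~j (InRange-≤ l' (n≤1+n j) r)) r
                   in w , w0 , λ _ → ok
    ... | no  ¬r = stay t , refl , λ r → contradiction r ¬r

    junction : (j : ℕ) → Σ S λ t → InRange l' j → 𝒞 t ≡ g j
    link : (j : ℕ) → Segment j (proj₁ (junction j))

    link j = segment j (proj₁ (junction j)) (proj₂ (junction j))

    junction zero    = s' , λ _ → trans (sym s~s') (trace-head {l' = l'} {g} trace)
    junction (suc j) = end (proj₁ (link j)) , λ r → colour-end (proj₂ (proj₂ (link j)) r)

    walks : ℕ → Walk
    walks j = proj₁ (link j)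

    open Concat l' g walks
      (λ j → proj₁ (proj₂ (link (suc j))))
      (trans (cong 𝒞 (proj₁ (proj₂ (link 0)))) (proj₂ (junction 0) (InRange-0 l')))
      (λ j → proj₂ (proj₂ (link j)))
    open Blocks (λ j → steps (walks j)) using (startLen)

    transferred : ColTrace K 𝒞 s' (l' , g)
    transferred = (startLen l' , concat) , (proj₁ (proj₂ (link 0)) , concat-⟶) , concat-contracts

lemma2p5 : {AP : Set} (K : Kripke AP) {Col : Set} (𝒞 : Kripke.S K → Col) →
    (∀ s s' → 𝒞 s ≡ 𝒞 s' → SameProps K 𝒞 s s' × SameTraces₂ K 𝒞 s s') →
    Consistent K 𝒞
lemma2p5 K 𝒞 hyp s s' s~s' =
  proj₁ (hyp s s' s~s') ,
  λ (l' , g) → Transfer.transferred K 𝒞 hyp s~s' {l'} {g}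
             , Transfer.transferred K 𝒞 hyp (sym s~s') {l'} {g}
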